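{- Every implicational formula is classically equivalent to an implicational formula of order at most three.
   Context: Implicational formulas: $\sigma::=p\mid\sigma\to\tau$ with $p$ a propositional variable. Order: $r(p)=0$, $r(\sigma\to\tau)=\max(r(\tau),r(\sigma)+1)$. Classical equivalence means having the same truth value under every Boolean valuation of the variables. -}

module Defs where

open import Data.Nat using (ℕ; zero; suc; _⊔_)
open import Data.Bool using (Bool; true; false; not; _∨_)
open import Relation.Binary.PropositionalEquality using (_≡_)

infixr 5 _⇒_
data Formula : Set where
  var : ℕ → Formula
  _⇒_ : Formula → Formula → Formula

order : Formula → ℕ
order (var _) = 0
order (σ ⇒ τ) = order τ ⊔ suc (order σ)

Valuation : Set
Valuation = ℕ → Bool

⟦_⟧ : Formula → Valuation → Bool
⟦ var p ⟧ v = v p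
⟦ σ ⇒ τ ⟧ v = not (⟦ σ ⟧ v) ∨ ⟦ τ ⟧ v

ClassicallyEquivalent : Formula → Formula → Set
ClassicallyEquivalent φ ψ = ∀ (v : Valuation) → ⟦ φ ⟧ v ≡ ⟦ ψ ⟧ v

-- Let q be the variable at the end of φ. Where q is true, φ is true. Where q is
-- false, q acts as falsum: var x ⇒ var q is ¬ x and h₁ ⇒ … ⇒ hₙ ⇒ var q is
-- ¬ (h₁ ∧ … ∧ hₙ). So the disjunctive normal form m₁ ∨ … ∨ mₖ of the truth table
-- of φ can be written ¬m₁ ⇒ … ⇒ ¬mₖ ⇒ var q, where each ¬mᵢ is an implication
-- of literals into var q, of order 2. This formula of order 3 is moreover true
-- wherever q is true, so it is equivalent to φ everywhere.
module Submission where

open import Defs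
open import Data.Nat using (ℕ; suc; _≤_; _≟_; z≤n; s≤s)
open import Data.Nat.Properties using (⊔-lub; ≤-refl)
open import Data.Bool using (Bool; true; false; not; _∨_; T; T?)
open import Data.Bool.Properties using (∨-zeroʳ; T-≡) renaming (_≟_ to _≟ᵇ_)
open import Data.List using (List; []; _∷_; _++_; map; filterᵇ)
open import Data.List.Membership.Propositional using (_∈_; lose)
open import Data.List.Membership.Propositional.Properties using (∈-map⁺; ∈-++⁺ˡ; ∈-++⁺ʳ; ∈-filter⁺; ∈-filter⁻)
open import Data.List.Relation.Unary.All as All using (All; []; _∷_; all?)
import Data.List.Relation.Unary.All.Properties as Allₚ
open import Data.List.Relation.Unary.Any as Any using (Any; here; there)
import Data.List.Relation.Unary.Any.Properties as Anyₚ
open import Data.Product using (Σ; ∃; _×_; _,_; proj₂)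
open import Data.Empty using (⊥-elim)
open import Function using (_∘_; const; Equivalence)
open import Relation.Nullary using (yes; no)
open import Relation.Binary.PropositionalEquality using (_≡_; _≢_; refl; sym; trans; cong; subst)

private
  variable
    v w : Valuation
    q x : ℕ
    k : ℕ
    r : Formula
    hs : List Formula
    xs : List ℕ

head : Formula → ℕ
head (var p) = p
head (σ ⇒ τ) = head τ

vars : Formula → List ℕ
vars (var p) = p ∷ []
vars (σ ⇒ τ) = vars σ ++ vars τ

_≈[_]_ : Valuation → List ℕ → Valuation → Set
v ≈[ xs ] w = All (λ x → v x ≡ w x) xs

⇒-trueʳ : ∀ σ τ → ⟦ τ ⟧ v ≡ true → ⟦ σ ⇒ τ ⟧ v ≡ true
⇒-trueʳ {v} σ τ τ-true = trans (cong (not (⟦ σ ⟧ v) ∨_) τ-true) (∨-zeroʳ _)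

⇒-trueˡ : ∀ σ τ → ⟦ σ ⟧ v ≡ false → ⟦ σ ⇒ τ ⟧ v ≡ true
⇒-trueˡ σ τ σ-false rewrite σ-false = refl

⇒-false : ∀ σ τ → ⟦ σ ⟧ v ≡ true → ⟦ τ ⟧ v ≡ false → ⟦ σ ⇒ τ ⟧ v ≡ false
⇒-false σ τ σ-true τ-false rewrite σ-true | τ-false = refl

⟦⟧-head : ∀ φ → v (head φ) ≡ true → ⟦ φ ⟧ v ≡ true
⟦⟧-head (var p) vp = vp
⟦⟧-head (σ ⇒ τ) vq = ⇒-trueʳ σ τ (⟦⟧-head τ vq)

⟦⟧-cong : ∀ φ → v ≈[ vars φ ] w → ⟦ φ ⟧ v ≡ ⟦ φ ⟧ w
⟦⟧-cong (var p) (vp≡wp ∷ []) = vp≡wp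
⟦⟧-cong (σ ⇒ τ) v≈w
  rewrite ⟦⟧-cong σ (Allₚ.++⁻ˡ (vars σ) v≈w) | ⟦⟧-cong τ (Allₚ.++⁻ʳ (vars σ) v≈w) = refl

infixr 4 _⇛_
_⇛_ : List Formula → Formula → Formula
[] ⇛ r = r
(h ∷ hs) ⇛ r = h ⇒ (hs ⇛ r)

order-⇛ : All (λ h → order h ≤ k) hs → order r ≤ suc k → order (hs ⇛ r) ≤ suc k
order-⇛ [] r≤ = r≤
order-⇛ (h≤ ∷ hs≤) r≤ = ⊔-lub (order-⇛ hs≤ r≤) (s≤s h≤)

⇛-trueʳ : ∀ hs r → ⟦ r ⟧ v ≡ true → ⟦ hs ⇛ r ⟧ v ≡ true
⇛-trueʳ [] r r-true = r-true
⇛-trueʳ (h ∷ hs) r r-true = ⇒-trueʳ h (hs ⇛ r) (⇛-trueʳ hs r r-true)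

⇛-trueˡ : ∀ r → Any (λ h → ⟦ h ⟧ v ≡ false) hs → ⟦ hs ⇛ r ⟧ v ≡ true
⇛-trueˡ {hs = h ∷ hs} r (here h-false) = ⇒-trueˡ h (hs ⇛ r) h-false
⇛-trueˡ {hs = h ∷ hs} r (there p) = ⇒-trueʳ h (hs ⇛ r) (⇛-trueˡ r p)

⇛-false : ∀ r → All (λ h → ⟦ h ⟧ v ≡ true) hs → ⟦ r ⟧ v ≡ false → ⟦ hs ⇛ r ⟧ v ≡ false
⇛-false r [] r-false = r-false
⇛-false {hs = h ∷ hs} r (h-true ∷ hs-true) r-false =
  ⇒-false h (hs ⇛ r) h-true (⇛-false r hs-true r-false)

literal : ℕ → Bool → ℕ → Formula
literal q true x = var x
literal q false x = var x ⇒ var q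

order-literal : ∀ b → order (literal q b x) ≤ 1
order-literal true = z≤n
order-literal false = ≤-refl

literal-true : ∀ {b} → b ≡ v x → ⟦ literal q b x ⟧ v ≡ true
literal-true {v} {x} refl with v x in vx
... | true = vx
... | false rewrite vx = refl

literal-false : ∀ {b} → v q ≡ false → b ≢ v x → ⟦ literal q b x ⟧ v ≡ false
literal-false {v} {q} {x} {true} vq true≢vx with v x in vx
... | true = ⊥-elim (true≢vx refl)
... | false = refl
literal-false {v} {q} {x} {false} vq false≢vx with v x in vx
... | true = vq
... | false = ⊥-elim (false≢vx refl)

_[_↦_] : Valuation → ℕ → Bool → Valuation
(w [ x ↦ b ]) y with x ≟ y
... | yes _ = b
... | no _ = w y

[↦]-agrees : ∀ x y → (x ≢ y → w y ≡ v y) → (w [ x ↦ v x ]) y ≡ v y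
[↦]-agrees x y x≢y⇒wy≡vy with x ≟ y
... | yes refl = refl
... | no x≢y = x≢y⇒wy≡vy x≢y

valuations : List ℕ → List Valuation
valuations [] = const false ∷ []
valuations (x ∷ xs) =
  map (_[ x ↦ true ]) (valuations xs) ++ map (_[ x ↦ false ]) (valuations xs)

[↦]-∈-valuations : ∀ xs x b → w ∈ valuations xs → w [ x ↦ b ] ∈ valuations (x ∷ xs)
[↦]-∈-valuations xs x true w∈ = ∈-++⁺ˡ (∈-map⁺ _ w∈)
[↦]-∈-valuations xs x false w∈ = ∈-++⁺ʳ (map _ (valuations xs)) (∈-map⁺ _ w∈)

valuations-complete : ∀ xs v → ∃ λ w → w ∈ valuations xs × w ≈[ xs ] v
valuations-complete [] v = const false , here refl , []
valuations-complete (x ∷ xs) v with valuations-complete xs v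
... | w , w∈ , w≈v =
  w [ x ↦ v x ] , [↦]-∈-valuations xs x (v x) w∈ ,
  [↦]-agrees {w = w} {v = v} x x (λ x≢x → ⊥-elim (x≢x refl))
    ∷ All.map (λ {y} wy≡vy → [↦]-agrees x y (const wy≡vy)) w≈v

maxterm : ℕ → List ℕ → Valuation → Formula
maxterm q xs w = map (λ x → literal q (w x) x) xs ⇛ var q

order-maxterm : ∀ xs → order (maxterm q xs w) ≤ 2
order-maxterm {w = w} xs = order-⇛ (Allₚ.map⁺ (All.universal (λ x → order-literal (w x)) xs)) z≤n

maxterm-false : v q ≡ false → w ≈[ xs ] v → ⟦ maxterm q xs w ⟧ v ≡ false
maxterm-false {q = q} vq w≈v = ⇛-false (var q) (Allₚ.map⁺ (All.map literal-true w≈v)) vq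

maxterm-true : v q ≡ false → Any (λ x → w x ≢ v x) xs → ⟦ maxterm q xs w ⟧ v ≡ true
maxterm-true {q = q} vq w≉v = ⇛-trueˡ (var q) (Anyₚ.map⁺ (Any.map (literal-false vq) w≉v))

_DependsOnlyOn_ : (Valuation → Bool) → List ℕ → Set
f DependsOnlyOn xs = ∀ {v w} → v ≈[ xs ] w → f v ≡ f w

dnf : ℕ → List ℕ → (Valuation → Bool) → Formula
dnf q xs f = map (maxterm q xs) (filterᵇ f (valuations xs)) ⇛ var q

order-dnf : ∀ xs f → order (dnf q xs f) ≤ 3
order-dnf xs f =
  order-⇛ (Allₚ.map⁺ (All.universal (λ _ → order-maxterm xs) (filterᵇ f (valuations xs)))) z≤n

⟦dnf⟧-true : ∀ xs f → v q ≡ true → ⟦ dnf q xs f ⟧ v ≡ true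
⟦dnf⟧-true {q = q} xs f vq =
  ⇛-trueʳ (map (maxterm q xs) (filterᵇ f (valuations xs))) (var q) vq

⟦dnf⟧-false : ∀ xs {f} → f DependsOnlyOn xs → v q ≡ false → ⟦ dnf q xs f ⟧ v ≡ f v
⟦dnf⟧-false {v} {q} xs {f} f-local vq with f v in fv
... | true =
  let w , w∈ , w≈v = valuations-complete xs v
      fw : T (f w)
      fw = Equivalence.from T-≡ (trans (f-local w≈v) fv)
  in ⇛-trueˡ (var q) (Anyₚ.map⁺ (lose (∈-filter⁺ (T? ∘ f) w∈ fw) (maxterm-false vq w≈v)))
... | false = ⇛-false (var q) (Allₚ.map⁺ (All.tabulate maxterm-true-on-filter)) vq
  where
  maxterm-true-on-filter : ∀ {w} → w ∈ filterᵇ f (valuations xs) → ⟦ maxterm q xs w ⟧ v ≡ true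
  maxterm-true-on-filter {w} w∈ with all? (λ x → w x ≟ᵇ v x) xs
  ... | yes w≈v =
    ⊥-elim (subst T (trans (f-local w≈v) fv) (proj₂ (∈-filter⁻ (T? ∘ f) {xs = valuations xs} w∈)))
  ... | no w≉v = maxterm-true vq (Allₚ.¬All⇒Any¬ (λ x → w x ≟ᵇ v x) xs w≉v)

proposition4p3 : (φ : Formula) → Σ Formula (λ ψ → (order ψ ≤ 3) × ClassicallyEquivalent φ ψ)
proposition4p3 φ = dnf (head φ) (vars φ) ⟦ φ ⟧ , order-dnf (vars φ) ⟦ φ ⟧ , φ≡dnf
  where
  φ≡dnf : ClassicallyEquivalent φ (dnf (head φ) (vars φ) ⟦ φ ⟧)
  φ≡dnf v with v (head φ) in vq
  ... | true = trans (⟦⟧-head φ vq) (sym (⟦dnf⟧-true (vars φ) ⟦ φ ⟧ vq))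
  ... | false = sym (⟦dnf⟧-false (vars φ) (⟦⟧-cong φ) vq)
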